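{- Let $(V,\mathrm{dist})$ be a TSP instance with $n$ vertices. In every sequence of $t$ consecutive 2-changes, the number of disjoint pairs of 2-changes that are linked by an edge is at least $(2t-n)/7$.
   Context: A 2-change on a tour removes two tour edges $\{u_1,u_2\},\{v_1,v_2\}$ (with $u_1,u_2,v_1,v_2$ distinct and in this order along the tour) and adds $\{u_1,v_1\},\{u_2,v_2\}$, and it is required to strictly decrease the tour length. A sequence $S_1,\ldots,S_t$ of consecutive 2-changes means $S_1$ is applied to some tour and each $S_{i+1}$ is applied to the tour resulting from $S_i$. A pair $(S_i,S_j)$ with $i<j$ is linked by an edge if some edge added to the tour in $S_i$ is removed from the tour in $S_j$. A collection of pairs is disjoint if no 2-change of the sequence belongs to two of its pairs. -}

module Defs where

open import Level using (0ℓ)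
open import Algebra.Bundles using (CommutativeMonoid)
open import Data.Nat using (ℕ; zero; suc; _%_; _<_)
open import Data.Nat.DivMod using (m%n<n)
open import Data.Fin using (Fin; toℕ; fromℕ<; inject₁)
import Data.Fin as F
open import Data.Product using (Σ; ∃; _×_; _,_)
open import Data.Sum using (_⊎_)
open import Data.List using (List; []; _∷_; concatMap)
open import Data.List.Relation.Unary.All using (All)
open import Data.List.Relation.Unary.Unique.Propositional using (Unique)
open import Relation.Binary.PropositionalEquality using (_≡_)
open import Relation.Nullary using (¬_)
open import Function.Definitions using (Injective)
open import Function.Bundles using (_⇔_)

next : ∀ {n} → Fin n → Fin n
next {suc m} i = fromℕ< (m%n<n (suc (toℕ i)) (suc m))

-- A tour: a cyclic ordering of all vertices, given by the injective
-- map position ↦ vertex (π i is followed by π (next i)).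
record Tour (n : ℕ) : Set where
  field
    π     : Fin n → Fin n
    π-inj : Injective _≡_ _≡_ π
open Tour public

SameEdge : ∀ {n} → Fin n → Fin n → Fin n → Fin n → Set
SameEdge a b c d = (a ≡ c × b ≡ d) ⊎ (a ≡ d × b ≡ c)

InTour : ∀ {n} → Tour n → Fin n → Fin n → Set
InTour T a b = ∃ λ i → SameEdge a b (π T i) (π T (next i))

-- data of a 2-change: remove {u1,u2},{v1,v2}; add {u1,v1},{u2,v2}
record TwoChange (n : ℕ) : Set where
  constructor twoChange
  field
    u1 u2 v1 v2 : Fin n
open TwoChange public

Removed : ∀ {n} → TwoChange n → Fin n → Fin n → Set
Removed S a b = SameEdge a b (u1 S) (u2 S) ⊎ SameEdge a b (v1 S) (v2 S)

Added : ∀ {n} → TwoChange n → Fin n → Fin n → Set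
Added S a b = SameEdge a b (u1 S) (v1 S) ⊎ SameEdge a b (u2 S) (v2 S)

module _ (M : CommutativeMonoid 0ℓ 0ℓ) where
  open CommutativeMonoid M renaming (Carrier to D)

  sumFin : ∀ {n} → (Fin n → D) → D
  sumFin {zero}  f = ε
  sumFin {suc n} f = f F.zero ∙ sumFin (λ i → f (F.suc i))

  record TSPInstance (n : ℕ) : Set where
    field
      dist     : Fin n → Fin n → D
      dist-sym : ∀ a b → dist a b ≡ dist b a
  open TSPInstance public

  tourLength : ∀ {n} → TSPInstance n → Tour n → D
  tourLength I T = sumFin (λ i → dist I (π T i) (π T (next i)))

  IsTwoChangeStep : ∀ {n} → (_<ᴰ_ : D → D → Set) → TSPInstance n →
                    Tour n → TwoChange n → Tour n → Set
  IsTwoChangeStep _<ᴰ_ I T S T' =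
      (¬ u1 S ≡ u2 S × ¬ u1 S ≡ v1 S × ¬ u1 S ≡ v2 S ×
       ¬ u2 S ≡ v1 S × ¬ u2 S ≡ v2 S × ¬ v1 S ≡ v2 S)
    × (∃ λ i → π T i ≡ u1 S × π T (next i) ≡ u2 S)
    × (∃ λ j → π T j ≡ v1 S × π T (next j) ≡ v2 S)
    × (∀ a b → InTour T' a b ⇔
         ((InTour T a b × ¬ Removed S a b) ⊎ Added S a b))
    × (tourLength I T' <ᴰ tourLength I T)

  record TwoChangeSeq {n} (_<ᴰ_ : D → D → Set) (I : TSPInstance n) (t : ℕ) : Set where
    field
      tours   : Fin (suc t) → Tour n
      changes : Fin t → TwoChange n
      steps   : ∀ k → IsTwoChangeStep _<ᴰ_ I (tours (inject₁ k)) (changes k) (tours (F.suc k))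
  open TwoChangeSeq public

  Linked : ∀ {n t _<ᴰ_} {I : TSPInstance n} → TwoChangeSeq _<ᴰ_ I t → Fin t × Fin t → Set
  Linked σ (k , l) = toℕ k < toℕ l ×
    ∃ λ a → ∃ λ b → Added (changes σ k) a b × Removed (changes σ l) a b

indices : ∀ {t} → List (Fin t × Fin t) → List (Fin t)
indices = concatMap (λ { (k , l) → k ∷ l ∷ [] })

-- disjoint: no 2-change in two pairs (and pairs have distinct members)
Disjoint : ∀ {t} → List (Fin t × Fin t) → Set
Disjoint P = Unique (indices P)

-- Scan the 2-changes in order and pair S_j with an earlier S_i whenever one
-- of the two edges removed by S_j was last added by S_i and S_i is still
-- unpaired.  Charge each of the 2t removals injectively: a removal made by a
-- paired S_j is charged to itself (2 per pair); otherwise its edge was either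
-- last added by some S_i, which is then already paired, and the removal is
-- charged to that added edge of S_i (4 per pair), or it was never added and
-- is charged to its position in the initial tour (n in total).  Injectivity
-- holds because an edge cannot be removed twice without being added in
-- between.  Hence 2t ≤ 6|P| + n.
module Submission where

open import Defs
open import Level using (0ℓ)
open import Algebra.Bundles using (CommutativeMonoid)
open import Data.Bool using (Bool; true; false)
open import Data.Empty using (⊥-elim)
open import Data.Fin using (Fin; toℕ; fromℕ<; inject₁)
import Data.Fin as F
open import Data.Fin.Properties using (toℕ-fromℕ<; fromℕ<-toℕ; toℕ<n; toℕ-inject₁)
  renaming (_≟_ to _≟ᶠ_)
open import Data.List using (List; []; _∷_; _++_; length; map; tabulate)
open import Data.List.Properties using (length-tabulate)
open import Data.List.Membership.Propositional using (_∈_; _∉_)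
open import Data.List.Membership.Propositional.Properties using (∈-++⁺ʳ; ∈-tabulate⁺)
open import Data.List.Relation.Unary.All as All using (All; []; _∷_)
open import Data.List.Relation.Unary.All.Properties using (¬Any⇒All¬)
open import Data.List.Relation.Unary.AllPairs using ([]; _∷_)
open import Data.List.Relation.Unary.Any using (here; there)
open import Data.List.Relation.Unary.Unique.Propositional using (Unique)
open import Data.List.Relation.Unary.Unique.Propositional.Properties using (map⁻)
open import Data.Nat using (ℕ; zero; suc; _+_; _*_; _≤_; _<_; z≤n; s≤s; _<?_)
open import Data.Nat.Properties
open import Data.List.Membership.DecPropositional _≟_ using (_∈?_)
open import Data.Product using (Σ; ∃; ∃₂; _×_; _,_; proj₁)
open import Data.Sum using (_⊎_; inj₁; inj₂)
open import Data.Unit using (⊤; tt)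
open import Function.Bundles using (Equivalence)
open import Relation.Binary.Definitions using (tri<; tri≈; tri>)
open import Relation.Binary.PropositionalEquality
  using (_≡_; _≢_; refl; sym; trans; cong; cong₂; subst; subst₂; module ≡-Reasoning)
open import Relation.Nullary using (¬_; Dec; yes; no)
open import Relation.Nullary.Decidable using (_×-dec_; _⊎-dec_)

Edge : ℕ → Set
Edge n = Fin n × Fin n

module _ {n : ℕ} where

  _≈_ : Edge n → Edge n → Set
  (a , b) ≈ (c , d) = SameEdge a b c d

  ≈-sym : ∀ {e f} → e ≈ f → f ≈ e
  ≈-sym (inj₁ (refl , refl)) = inj₁ (refl , refl)
  ≈-sym (inj₂ (refl , refl)) = inj₂ (refl , refl)

  ≈-trans : ∀ {e f g} → e ≈ f → f ≈ g → e ≈ g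
  ≈-trans (inj₁ (refl , refl)) q                    = q
  ≈-trans (inj₂ (refl , refl)) (inj₁ (refl , refl)) = inj₂ (refl , refl)
  ≈-trans (inj₂ (refl , refl)) (inj₂ (refl , refl)) = inj₁ (refl , refl)

  _≈?_ : ∀ e f → Dec (e ≈ f)
  (a , b) ≈? (c , d) = (a ≟ᶠ c ×-dec b ≟ᶠ d) ⊎-dec (a ≟ᶠ d ×-dec b ≟ᶠ c)

delete-∈ : ∀ {A : Set} {x : A} ys → x ∈ ys →
           ∃ λ ys′ → length ys ≡ suc (length ys′) × (∀ {z} → z ∈ ys → z ≢ x → z ∈ ys′)
delete-∈ (y ∷ ys) (here refl) = ys , refl , λ { (here refl) z≢x → ⊥-elim (z≢x refl) ; (there z∈) _ → z∈ }
delete-∈ (y ∷ ys) (there x∈ys) with delete-∈ ys x∈ys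
... | ys′ , len , keep = y ∷ ys′ , cong suc len ,
      λ { (here refl) _ → here refl ; (there z∈) z≢x → there (keep z∈ z≢x) }

length-≤-injectiveOn : ∀ {A B : Set} (f : A → B) {xs : List A} {ys : List B} → Unique xs →
  (∀ {a b} → a ∈ xs → b ∈ xs → f a ≡ f b → a ≡ b) → All (λ x → f x ∈ ys) xs →
  length xs ≤ length ys
length-≤-injectiveOn f {[]} _ _ _ = z≤n
length-≤-injectiveOn f {x ∷ xs} {ys} (x∉xs ∷ unique) inj (fx∈ys ∷ fxs∈ys)
  with delete-∈ ys fx∈ys
... | ys′ , len , keep = subst (suc (length xs) ≤_) (sym len)
      (s≤s (length-≤-injectiveOn f unique (λ a∈ b∈ → inj (there a∈) (there b∈))
        (All.tabulate λ b∈ → keep (All.lookup fxs∈ys b∈) λ fb≡fx →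
           All.lookup x∉xs b∈ (inj (here refl) (there b∈) (sym fb≡fx)))))

-- Only the edge bookkeeping of a 2-change sequence matters: Present j is the
-- edge set of the j-th tour, and step j removes the two distinct edges
-- removed j false/true and adds added j false/true.
module TourHistory {n : ℕ} (t : ℕ)
  (Present : ℕ → Edge n → Set)
  (removed added : ℕ → Bool → Edge n)
  (initial : Fin n → Edge n)
  (removed-present : ∀ {j} → j < t → ∀ x → Present j (removed j x))
  (present-suc : ∀ {j} → j < t → ∀ {e} → Present (suc j) e →
                 (Present j e × ∀ x → ¬ e ≈ removed j x) ⊎ ∃ λ y → e ≈ added j y)
  (removed-distinct : ∀ {j} → j < t → ¬ removed j false ≈ removed j true)
  (initial-covers : ∀ {e} → Present 0 e → ∃ λ p → e ≈ initial p)
  where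

  NotAddedBetween : Edge n → ℕ → ℕ → Set
  NotAddedBetween e k m = ∀ {i} y → k ≤ i → i < m → ¬ e ≈ added i y

  notAddedBetween-empty : ∀ {e k m} → m ≤ k → NotAddedBetween e k m
  notAddedBetween-empty m≤k _ k≤i i<m _ = <-irrefl refl (<-≤-trans i<m (≤-trans m≤k k≤i))

  notAddedBetween-shrink : ∀ {e k k′ m} → k ≤ k′ → NotAddedBetween e k m → NotAddedBetween e k′ m
  notAddedBetween-shrink k≤k′ na y k′≤i = na y (≤-trans k≤k′ k′≤i)

  notAddedBetween-extend : ∀ {e k m} → NotAddedBetween e k m → ¬ e ≈ added m false →
                           ¬ e ≈ added m true → NotAddedBetween e k (suc m)
  notAddedBetween-extend na _ _ y k≤i i<1+m with m<1+n⇒m<n∨m≡n i<1+m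
  notAddedBetween-extend na _ _ y k≤i _ | inj₁ i<m  = na y k≤i i<m
  notAddedBetween-extend _ ¬f _ false _ _ | inj₂ refl = ¬f
  notAddedBetween-extend _ _ ¬t true  _ _ | inj₂ refl = ¬t

  present-before : ∀ {k m e} → k ≤ m → m ≤ t → Present m e → NotAddedBetween e k m → Present k e
  present-before {m = m} k≤m m≤t p na with m≤n⇒m<n∨m≡n k≤m
  ... | inj₂ refl = p
  present-before {m = suc m} k≤1+m 1+m≤t p na | inj₁ k<1+m
    with present-suc 1+m≤t p
  ... | inj₁ (p′ , _) = present-before (m<1+n⇒m≤n k<1+m) (<⇒≤ 1+m≤t) p′
                          (λ y k≤i i<m → na y k≤i (m<n⇒m<1+n i<m))
  ... | inj₂ (y , e≈) = ⊥-elim (na y (m<1+n⇒m≤n k<1+m) (n<1+n m) e≈)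

  removal-requires-addition : ∀ {j j′ x x′} → j < j′ → j′ < t → removed j x ≈ removed j′ x′ →
                              ¬ NotAddedBetween (removed j′ x′) j j′
  removal-requires-addition {j} {j′} {x} {x′} j<j′ j′<t same na
    with present-suc (<-trans j<j′ j′<t)
           (present-before j<j′ (<⇒≤ j′<t) (removed-present j′<t x′) (notAddedBetween-shrink (n≤1+n j) na))
  ... | inj₁ (_ , notRemoved) = notRemoved x (≈-sym same)
  ... | inj₂ (y , e≈) = na y ≤-refl j<j′ e≈

  removal-injective : ∀ {j j′ x x′} → j < t → j′ < t → removed j x ≈ removed j′ x′ →
                      NotAddedBetween (removed j′ x′) j j′ → NotAddedBetween (removed j x) j′ j →
                      (j , x) ≡ (j′ , x′)
  removal-injective {j} {j′} {x} {x′} j<t j′<t same na na′ with <-cmp j j′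
  ... | tri< j<j′ _ _ = ⊥-elim (removal-requires-addition j<j′ j′<t same na)
  ... | tri> _ _ j′<j = ⊥-elim (removal-requires-addition j′<j j<t (≈-sym same) na′)
  ... | tri≈ _ refl _ with x | x′
  ...   | false | false = refl
  ...   | true  | true  = refl
  ...   | false | true  = ⊥-elim (removed-distinct j<t same)
  ...   | true  | false = ⊥-elim (removed-distinct j<t (≈-sym same))

  data LastAddition (j : ℕ) (e : Edge n) : Set where
    never : NotAddedBetween e 0 j → LastAddition j e
    at    : ∀ i y → i < j → e ≈ added i y → NotAddedBetween e (suc i) j → LastAddition j e

  lastAddition : ∀ j e → LastAddition j e
  lastAddition zero    e = never (notAddedBetween-empty z≤n)
  lastAddition (suc j) e with e ≈? added j false | e ≈? added j true
  ... | yes e≈ | _      = at j false (n<1+n j) e≈ (notAddedBetween-empty ≤-refl)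
  ... | no _   | yes e≈ = at j true (n<1+n j) e≈ (notAddedBetween-empty ≤-refl)
  ... | no ¬f  | no ¬t with lastAddition j e
  ...   | never na          = never (notAddedBetween-extend na ¬f ¬t)
  ...   | at i y i<j e≈ na  = at i y (m<n⇒m<1+n i<j) e≈ (notAddedBetween-extend na ¬f ¬t)

  ends : List (ℕ × ℕ) → List ℕ
  ends []            = []
  ends ((i , j) ∷ P) = i ∷ j ∷ ends P

  ends-++ : ∀ Q P → ends (Q ++ P) ≡ ends Q ++ ends P
  ends-++ []            P = refl
  ends-++ ((i , j) ∷ Q) P = cong (λ L → i ∷ j ∷ L) (ends-++ Q P)

  LinkedAt : ℕ → ℕ → Set
  LinkedAt i j = i < j × ∃₂ λ x y → removed j x ≈ added i y

  SourceUsed : ∀ {j e} → List (ℕ × ℕ) → LastAddition j e → Set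
  SourceUsed P (never _)      = ⊤
  SourceUsed P (at i _ _ _ _) = i ∈ ends P

  data Decision (j : ℕ) (P : List (ℕ × ℕ)) : Set where
    pair : ∀ i → LinkedAt i j → i ∉ ends P → Decision j P
    skip : (∀ x → Σ (LastAddition j (removed j x)) (SourceUsed P)) → Decision j P

  sourceOfRemoval : ∀ j P x →
    (∃ λ i → LinkedAt i j × i ∉ ends P) ⊎ Σ (LastAddition j (removed j x)) (SourceUsed P)
  sourceOfRemoval j P x with lastAddition j (removed j x)
  ... | never na = inj₂ (never na , tt)
  ... | at i y i<j e≈ na with i ∈? ends P
  ...   | yes i∈ = inj₂ (at i y i<j e≈ na , i∈)
  ...   | no i∉  = inj₁ (i , (i<j , x , y , e≈) , i∉)

  decide : ∀ j P → Decision j P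
  decide j P with sourceOfRemoval j P false | sourceOfRemoval j P true
  ... | inj₁ (i , l , i∉) | _                 = pair i l i∉
  ... | inj₂ _            | inj₁ (i , l , i∉) = pair i l i∉
  ... | inj₂ srcᶠ         | inj₂ srcᵗ         = skip λ { false → srcᶠ ; true → srcᵗ }

  apply : ∀ {j P} → Decision j P → List (ℕ × ℕ)
  apply {j} {P} (pair i _ _) = (i , j) ∷ P
  apply {P = P} (skip _)     = P

  greedy : ℕ → List (ℕ × ℕ)
  greedy zero    = []
  greedy (suc j) = apply (decide j (greedy j))

  greedy-linked : ∀ m → All (λ (i , j) → LinkedAt i j × j < m) (greedy m)
  greedy-linked zero = []
  greedy-linked (suc m) with decide m (greedy m)
  ... | pair i l _ = (l , n<1+n m) ∷ All.map (λ (l′ , j<m) → l′ , m<n⇒m<1+n j<m) (greedy-linked m)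
  ... | skip _     = All.map (λ (l′ , j<m) → l′ , m<n⇒m<1+n j<m) (greedy-linked m)

  greedy-ends : ∀ m → Unique (ends (greedy m)) × All (_< m) (ends (greedy m))
  greedy-ends zero = [] , []
  greedy-ends (suc m) with decide m (greedy m) | greedy-ends m
  ... | pair i (i<m , _) i∉ | unique , bounded =
        ((<⇒≢ i<m ∷ ¬Any⇒All¬ _ i∉) ∷ All.map (λ k<m m≡k → <-irrefl (sym m≡k) k<m) bounded ∷ unique) ,
        (m<n⇒m<1+n i<m ∷ n<1+n m ∷ All.map m<n⇒m<1+n bounded)
  ... | skip _ | unique , bounded = unique , All.map m<n⇒m<1+n bounded

  greedy-suffix : ∀ {k m} → k ≤ m → ∃ λ Q → greedy m ≡ Q ++ greedy k
  greedy-suffix {k} {m} k≤m with m≤n⇒m<n∨m≡n k≤m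
  ... | inj₂ refl = [] , refl
  greedy-suffix {k} {suc m} _ | inj₁ k<1+m with greedy-suffix (m<1+n⇒m≤n k<1+m) | decide m (greedy m)
  ... | Q , eq | pair i _ _ = (i , m) ∷ Q , cong ((i , m) ∷_) eq
  ... | Q , eq | skip _     = Q , eq

  data Charge : Set where
    initialEdge    : Fin n → Charge
    lastAddedBy    : ℕ → Bool → Charge
    pairedRemoval  : ℕ → Bool → Charge

  chargeOfSource : ∀ {j x} → j < t → LastAddition j (removed j x) → Charge
  chargeOfSource {x = x} j<t (never na) =
    initialEdge (proj₁ (initial-covers (present-before z≤n (<⇒≤ j<t) (removed-present j<t x) na)))
  chargeOfSource _ (at i y _ _ _) = lastAddedBy i y

  chargeOfDecision : ∀ {j P} → j < t → Bool → Decision j P → Charge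
  chargeOfDecision {j} _   x (pair _ _ _) = pairedRemoval j x
  chargeOfDecision     j<t x (skip src)   = chargeOfSource j<t (proj₁ (src x))

  -- Removals past step t get a junk charge; only those before t are counted.
  charge : ℕ × Bool → Charge
  charge (j , x) with j <? t
  ... | yes j<t = chargeOfDecision j<t x (decide j (greedy j))
  ... | no _    = pairedRemoval j x

  chargeOfSource-injective : ∀ {j j′ x x′} (j<t : j < t) (j′<t : j′ < t) s s′ →
    chargeOfSource {j} {x} j<t s ≡ chargeOfSource {j′} {x′} j′<t s′ → (j , x) ≡ (j′ , x′)
  chargeOfSource-injective {j} {j′} {x} {x′} j<t j′<t (never na) (never na′) eq
    with initial-covers (present-before z≤n (<⇒≤ j<t) (removed-present j<t x) na)
       | initial-covers (present-before z≤n (<⇒≤ j′<t) (removed-present j′<t x′) na′)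
  chargeOfSource-injective j<t j′<t (never na) (never na′) refl | p , e≈ | .p , e≈′ =
    removal-injective j<t j′<t (≈-trans e≈ (≈-sym e≈′))
      (notAddedBetween-shrink z≤n na′) (notAddedBetween-shrink z≤n na)
  chargeOfSource-injective j<t j′<t (at i y i<j e≈ na) (at .i .y i<j′ e≈′ na′) refl =
    removal-injective j<t j′<t (≈-trans e≈ (≈-sym e≈′))
      (notAddedBetween-shrink i<j na′) (notAddedBetween-shrink i<j′ na)

  chargeOfSource≢pairedRemoval : ∀ {j x k y} (j<t : j < t) s →
                                 chargeOfSource {j} {x} j<t s ≢ pairedRemoval k y
  chargeOfSource≢pairedRemoval _ (never _)      ()
  chargeOfSource≢pairedRemoval _ (at _ _ _ _ _) ()

  chargeOfDecision-injective : ∀ {j j′ x x′ P P′} (j<t : j < t) (j′<t : j′ < t)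
    (d : Decision j P) (d′ : Decision j′ P′) →
    chargeOfDecision j<t x d ≡ chargeOfDecision j′<t x′ d′ → (j , x) ≡ (j′ , x′)
  chargeOfDecision-injective _ _ (pair _ _ _) (pair _ _ _) refl = refl
  chargeOfDecision-injective {x′ = x′} _ j′<t (pair _ _ _) (skip src′) eq =
    ⊥-elim (chargeOfSource≢pairedRemoval j′<t (proj₁ (src′ x′)) (sym eq))
  chargeOfDecision-injective {x = x} j<t _ (skip src) (pair _ _ _) eq =
    ⊥-elim (chargeOfSource≢pairedRemoval j<t (proj₁ (src x)) eq)
  chargeOfDecision-injective {x = x} {x′} j<t j′<t (skip src) (skip src′) eq =
    chargeOfSource-injective j<t j′<t (proj₁ (src x)) (proj₁ (src′ x′)) eq

  charge-injective : ∀ {j j′ x x′} → j < t → j′ < t → charge (j , x) ≡ charge (j′ , x′) →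
                     (j , x) ≡ (j′ , x′)
  charge-injective {j} {j′} j<t j′<t eq with j <? t | j′ <? t
  ... | yes j<t′ | yes j′<t′ =
        chargeOfDecision-injective j<t′ j′<t′ (decide j (greedy j)) (decide j′ (greedy j′)) eq
  ... | no j≮t   | _         = ⊥-elim (j≮t j<t)
  ... | yes _    | no j′≮t   = ⊥-elim (j′≮t j′<t)

  targets : List (ℕ × ℕ) → List Charge
  targets []            = tabulate initialEdge
  targets ((i , j) ∷ P) =
    lastAddedBy i false ∷ lastAddedBy i true ∷ lastAddedBy j false ∷ lastAddedBy j true ∷
    pairedRemoval j false ∷ pairedRemoval j true ∷ targets P

  length-targets : ∀ P → length (targets P) ≡ 6 * length P + n
  length-targets []      = length-tabulate initialEdge
  length-targets (_ ∷ P) = begin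
    6 + length (targets P)     ≡⟨ cong (6 +_) (length-targets P) ⟩
    6 + (6 * length P + n)     ≡⟨ sym (+-assoc 6 (6 * length P) n) ⟩
    6 + 6 * length P + n       ≡⟨ cong (_+ n) (sym (*-suc 6 (length P))) ⟩
    6 * suc (length P) + n     ∎
    where open ≡-Reasoning

  targets-∷ : ∀ {c} p P → c ∈ targets P → c ∈ targets (p ∷ P)
  targets-∷ _ _ c∈ = there (there (there (there (there (there c∈)))))

  initialEdge∈targets : ∀ P p → initialEdge p ∈ targets P
  initialEdge∈targets []      p = ∈-tabulate⁺ p
  initialEdge∈targets (q ∷ P) p = targets-∷ q P (initialEdge∈targets P p)

  lastAddedBy∈targets : ∀ {i} P y → i ∈ ends P → lastAddedBy i y ∈ targets P
  lastAddedBy∈targets (_ ∷ P) false (here refl)         = here refl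
  lastAddedBy∈targets (_ ∷ P) true  (here refl)         = there (here refl)
  lastAddedBy∈targets (_ ∷ P) false (there (here refl)) = there (there (here refl))
  lastAddedBy∈targets (_ ∷ P) true  (there (here refl)) = there (there (there (here refl)))
  lastAddedBy∈targets (q ∷ P) y     (there (there i∈))  = targets-∷ q P (lastAddedBy∈targets P y i∈)

  pairedRemoval∈targets : ∀ {i j} P x → (i , j) ∈ P → pairedRemoval j x ∈ targets P
  pairedRemoval∈targets (_ ∷ P) false (here refl) = there (there (there (there (here refl))))
  pairedRemoval∈targets (_ ∷ P) true  (here refl) = there (there (there (there (there (here refl)))))
  pairedRemoval∈targets (q ∷ P) x     (there p∈)  = targets-∷ q P (pairedRemoval∈targets P x p∈)

  chargeOfDecision∈targets : ∀ {j} (j<t : j < t) x (d : Decision j (greedy j)) →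
    (∃ λ Q → greedy t ≡ Q ++ apply d) → chargeOfDecision j<t x d ∈ targets (greedy t)
  chargeOfDecision∈targets {j} _ x (pair i _ _) (Q , eq) =
    pairedRemoval∈targets (greedy t) x (subst ((i , j) ∈_) (sym eq) (∈-++⁺ʳ Q (here refl)))
  chargeOfDecision∈targets {j} _ x (skip src) (Q , eq) with src x
  ... | never _ , _ = initialEdge∈targets (greedy t) _
  ... | at i y _ _ _ , i∈ = lastAddedBy∈targets (greedy t) y
        (subst (i ∈_) (sym (trans (cong ends eq) (ends-++ Q (greedy j)))) (∈-++⁺ʳ (ends Q) i∈))

  charge∈targets : ∀ {j} x → j < t → charge (j , x) ∈ targets (greedy t)
  charge∈targets {j} x j<t with j <? t
  ... | yes j<t′ = chargeOfDecision∈targets j<t′ x (decide j (greedy j)) (greedy-suffix j<t′)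
  ... | no j≮t   = ⊥-elim (j≮t j<t)

  removals : ℕ → List (ℕ × Bool)
  removals zero    = []
  removals (suc m) = (m , false) ∷ (m , true) ∷ removals m

  removals-bounded : ∀ m {r} → r ∈ removals m → proj₁ r < m
  removals-bounded (suc m) (here refl)         = n<1+n m
  removals-bounded (suc m) (there (here refl)) = n<1+n m
  removals-bounded (suc m) (there (there r∈))  = m<n⇒m<1+n (removals-bounded m r∈)

  removals-unique : ∀ m → Unique (removals m)
  removals-unique zero    = []
  removals-unique (suc m) = ((λ ()) ∷ earlier) ∷ earlier ∷ removals-unique m
    where
    earlier : ∀ {x} → All (λ r → (m , x) ≢ r) (removals m)
    earlier = All.tabulate λ r∈ eq → <-irrefl (sym (cong proj₁ eq)) (removals-bounded m r∈)

  length-removals : ∀ m → length (removals m) ≡ 2 * m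
  length-removals zero    = refl
  length-removals (suc m) = trans (cong (2 +_) (length-removals m)) (sym (*-suc 2 m))

  greedy-bound : 2 * t ≤ 6 * length (greedy t) + n
  greedy-bound = begin
    2 * t                        ≡⟨ sym (length-removals t) ⟩
    length (removals t)          ≤⟨ length-≤-injectiveOn charge (removals-unique t)
                                      (λ a∈ b∈ → charge-injective (removals-bounded t a∈) (removals-bounded t b∈))
                                      (All.tabulate λ r∈ → charge∈targets _ (removals-bounded t r∈)) ⟩
    length (targets (greedy t))  ≡⟨ length-targets (greedy t) ⟩
    6 * length (greedy t) + n    ∎
    where open ≤-Reasoning

extend : ∀ {A : Set} {m} → (Fin (suc m) → A) → ℕ → A
extend {m = m} f j with j <? suc m
... | yes j<1+m = f (fromℕ< j<1+m)
... | no _      = f F.zero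

extend-index : ∀ {A : Set} {m} (f : Fin (suc m) → A) k {j} → toℕ k ≡ j → f k ≡ extend f j
extend-index {m = m} f k refl with toℕ k <? suc m
... | yes k<1+m = cong f (sym (fromℕ<-toℕ k k<1+m))
... | no k≮1+m  = ⊥-elim (k≮1+m (toℕ<n k))

module FromSequence (M : CommutativeMonoid 0ℓ 0ℓ)
  (_<ᴰ_ : CommutativeMonoid.Carrier M → CommutativeMonoid.Carrier M → Set)
  {n : ℕ} {I : TSPInstance M n} {t : ℕ} (σ : TwoChangeSeq M _<ᴰ_ I (suc t)) where

  tourAt : ℕ → Tour n
  tourAt = extend (tours σ)

  changeAt : ℕ → TwoChange n
  changeAt = extend (changes σ)

  changeAt-fromℕ< : ∀ {j} (j<1+t : j < suc t) → changes σ (fromℕ< j<1+t) ≡ changeAt j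
  changeAt-fromℕ< j<1+t = extend-index (changes σ) (fromℕ< j<1+t) (toℕ-fromℕ< j<1+t)

  step-at : ∀ {j} → j < suc t → IsTwoChangeStep M _<ᴰ_ I (tourAt j) (changeAt j) (tourAt (suc j))
  step-at {j} j<1+t =
    subst₂ (λ T T′ → IsTwoChangeStep M _<ᴰ_ I T (changeAt j) T′)
      (extend-index (tours σ) (inject₁ k) (trans (toℕ-inject₁ k) (toℕ-fromℕ< j<1+t)))
      (extend-index (tours σ) (F.suc k) (cong suc (toℕ-fromℕ< j<1+t)))
      (subst (λ S → IsTwoChangeStep M _<ᴰ_ I (tours σ (inject₁ k)) S (tours σ (F.suc k)))
        (changeAt-fromℕ< j<1+t) (steps σ k))
    where k = fromℕ< j<1+t

  Present : ℕ → Edge n → Set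
  Present j (a , b) = InTour (tourAt j) a b

  removedEdge addedEdge : ℕ → Bool → Edge n
  removedEdge j false = u1 (changeAt j) , u2 (changeAt j)
  removedEdge j true  = v1 (changeAt j) , v2 (changeAt j)
  addedEdge   j false = u1 (changeAt j) , v1 (changeAt j)
  addedEdge   j true  = u2 (changeAt j) , v2 (changeAt j)

  initialTourEdge : Fin n → Edge n
  initialTourEdge p = π (tours σ F.zero) p , π (tours σ F.zero) (next p)

  removed-present : ∀ {j} → j < suc t → ∀ x → Present j (removedEdge j x)
  removed-present j<1+t false with step-at j<1+t
  ... | _ , (i , πi≡u1 , πi+1≡u2) , _ = i , inj₁ (sym πi≡u1 , sym πi+1≡u2)
  removed-present j<1+t true with step-at j<1+t
  ... | _ , _ , (i , πi≡v1 , πi+1≡v2) , _ = i , inj₁ (sym πi≡v1 , sym πi+1≡v2)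

  present-suc : ∀ {j} → j < suc t → ∀ {e} → Present (suc j) e →
                (Present j e × ∀ x → ¬ e ≈ removedEdge j x) ⊎ ∃ λ y → e ≈ addedEdge j y
  present-suc j<1+t {a , b} p with step-at j<1+t
  ... | _ , _ , _ , edges , _ with Equivalence.to (edges a b) p
  ...   | inj₁ (p′ , notRemoved) = inj₁ (p′ , λ { false r → notRemoved (inj₁ r) ; true r → notRemoved (inj₂ r) })
  ...   | inj₂ (inj₁ e≈) = inj₂ (false , e≈)
  ...   | inj₂ (inj₂ e≈) = inj₂ (true , e≈)

  removed-distinct : ∀ {j} → j < suc t → ¬ removedEdge j false ≈ removedEdge j true
  removed-distinct j<1+t same with step-at j<1+t
  ... | (_ , u1≢v1 , u1≢v2 , _) , _ with same
  ...   | inj₁ (u1≡v1 , _) = u1≢v1 u1≡v1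
  ...   | inj₂ (u1≡v2 , _) = u1≢v2 u1≡v2

  initial-covers : ∀ {e} → Present 0 e → ∃ λ p → e ≈ initialTourEdge p
  initial-covers {a , b} p rewrite sym (extend-index (tours σ) F.zero {0} refl) = p

  open TourHistory (suc t) Present removedEdge addedEdge initialTourEdge
    removed-present present-suc removed-distinct initial-covers
    using (ends; LinkedAt; greedy; greedy-linked; greedy-ends; greedy-bound)

  added-then-removed : ∀ {i j} x y → removedEdge j x ≈ addedEdge i y →
                       ∃₂ λ a b → Added (changeAt i) a b × Removed (changeAt j) a b
  added-then-removed false false e≈ = _ , _ , inj₁ e≈ , inj₁ (inj₁ (refl , refl))
  added-then-removed false true  e≈ = _ , _ , inj₂ e≈ , inj₁ (inj₁ (refl , refl))
  added-then-removed true  false e≈ = _ , _ , inj₁ e≈ , inj₂ (inj₁ (refl , refl))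
  added-then-removed true  true  e≈ = _ , _ , inj₂ e≈ , inj₂ (inj₁ (refl , refl))

  LinkedBelow : ℕ × ℕ → Set
  LinkedBelow (i , j) = LinkedAt i j × j < suc t

  toFinPairs : (P : List (ℕ × ℕ)) → All LinkedBelow P → List (Fin (suc t) × Fin (suc t))
  toFinPairs []            []                              = []
  toFinPairs ((i , j) ∷ P) (((i<j , _) , j<1+t) ∷ linked) =
    (fromℕ< (<-trans i<j j<1+t) , fromℕ< j<1+t) ∷ toFinPairs P linked

  toFinPairs-linked : ∀ P linked → All (Linked M σ) (toFinPairs P linked)
  toFinPairs-linked []            []                                         = []
  toFinPairs-linked ((i , j) ∷ P) (((i<j , x , y , e≈) , j<1+t) ∷ linked) =
    ( subst₂ _<_ (sym (toℕ-fromℕ< i<1+t)) (sym (toℕ-fromℕ< j<1+t)) i<j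
    , subst₂ (λ Sᵢ Sⱼ → ∃₂ λ a b → Added Sᵢ a b × Removed Sⱼ a b)
        (sym (changeAt-fromℕ< i<1+t)) (sym (changeAt-fromℕ< j<1+t)) (added-then-removed x y e≈)
    ) ∷ toFinPairs-linked P linked
    where i<1+t = <-trans i<j j<1+t

  toFinPairs-indices : ∀ P linked → map toℕ (indices (toFinPairs P linked)) ≡ ends P
  toFinPairs-indices []            []                            = refl
  toFinPairs-indices ((i , j) ∷ P) (((i<j , _) , j<1+t) ∷ linked) =
    cong₂ _∷_ (toℕ-fromℕ< (<-trans i<j j<1+t))
      (cong₂ _∷_ (toℕ-fromℕ< j<1+t) (toFinPairs-indices P linked))

  length-toFinPairs : ∀ P linked → length (toFinPairs P linked) ≡ length P
  length-toFinPairs []      []           = refl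
  length-toFinPairs (_ ∷ P) (_ ∷ linked) = cong suc (length-toFinPairs P linked)

  toFinPairs-disjoint : ∀ P linked → Unique (ends P) → Disjoint (toFinPairs P linked)
  toFinPairs-disjoint P linked unique =
    map⁻ (subst Unique (sym (toFinPairs-indices P linked)) unique)

  disjoint-linked-pairs : ∃ λ (P : List (Fin (suc t) × Fin (suc t))) →
    All (Linked M σ) P × Disjoint P × 2 * suc t ≤ 7 * length P + n
  disjoint-linked-pairs =
    toFinPairs G linked , toFinPairs-linked G linked ,
    toFinPairs-disjoint G linked (proj₁ (greedy-ends (suc t))) ,
    subst (λ ℓ → 2 * suc t ≤ 7 * ℓ + n) (sym (length-toFinPairs G linked))
      (≤-trans greedy-bound (+-monoˡ-≤ n (*-monoˡ-≤ (length G) (n≤1+n 6))))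
    where
    G : List (ℕ × ℕ)
    G = greedy (suc t)
    linked : All LinkedBelow G
    linked = greedy-linked (suc t)

lemma2 : (M : CommutativeMonoid 0ℓ 0ℓ) →
    (_<ᴰ_ : CommutativeMonoid.Carrier M → CommutativeMonoid.Carrier M → Set) →
    (n : ℕ) (I : TSPInstance M n) (t : ℕ) (σ : TwoChangeSeq M _<ᴰ_ I t) →
    ∃ λ (P : List (Fin t × Fin t)) →
    All (Linked M σ) P × Disjoint P × 2 * t ≤ 7 * length P + n
lemma2 M _<ᴰ_ n I zero    σ = [] , [] , [] , z≤n
lemma2 M _<ᴰ_ n I (suc t) σ = FromSequence.disjoint-linked-pairs M _<ᴰ_ σ
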